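{- For any connected graph $G$ and any vertex $v$ of $G$, $A(G;v)\geq (|G|+1)/2$, where $|G|$ is the number of vertices of $G$.
   Context: All graphs are finite and simple. A connected set of a graph $G$ is a nonempty set of vertices of $G$ that induces a connected subgraph of $G$. $A(G;v)$ denotes the average cardinality of a connected set of $G$ containing $v$, the average being taken over all connected sets of $G$ that contain $v$. -}

module Defs where

open import Level using (0ℓ)
open import Data.Nat using (ℕ; _+_; _*_; _≤_)
open import Data.Fin using (Fin)
open import Data.Fin.Subset using (Subset; _∈_; Nonempty; ∣_∣)
open import Data.List using (List; map; length)
open import Data.Nat.ListAction using (sum)
open import Data.List.Membership.Propositional renaming (_∈_ to _∈ˡ_)
open import Data.List.Relation.Unary.Unique.Propositional using (Unique)
open import Data.Product using (_×_)
open import Relation.Nullary using (¬_)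
open import Function.Bundles using (_⇔_)

record Graph (n : ℕ) : Set₁ where
  field
    Adj     : Fin n → Fin n → Set
    sym     : ∀ {x y} → Adj x y → Adj y x
    irrefl  : ∀ {x} → ¬ Adj x x
open Graph public

order : ∀ {n} → Graph n → ℕ
order {n} _ = n

data Reach {n} (G : Graph n) (S : Subset n) (u : Fin n) : Fin n → Set where
  here : u ∈ S → Reach G S u u
  step : ∀ {x y} → Reach G S u x → Adj G x y → y ∈ S → Reach G S u y

InducesConnected : ∀ {n} → Graph n → Subset n → Set
InducesConnected G S = ∀ u w → u ∈ S → w ∈ S → Reach G S u w

ConnectedSet : ∀ {n} → Graph n → Subset n → Set
ConnectedSet G S = Nonempty S × InducesConnected G S

ConnectedGraph : ∀ {n} → Graph n → Set
ConnectedGraph {n} G = ConnectedSet G (Data.Fin.Subset.⊤)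

EnumeratesConnectedSetsAt : ∀ {n} → Graph n → Fin n → List (Subset n) → Set
EnumeratesConnectedSetsAt G v L =
  Unique L × (∀ S → (S ∈ˡ L) ⇔ (ConnectedSet G S × v ∈ S))

totalSize : ∀ {n} → List (Subset n) → ℕ
totalSize L = sum (map ∣_∣ L)

-- Prove the stronger statement that for a nonempty connected set T contained in a
-- connected set K, the connected sets S with T ⊆ S ⊆ K have average size at least
-- (|K| + |T|)/2; the theorem is the case T = {v}, K = V(G).  Induct on |K| − |T|.
-- If T ≠ K, pick x ∈ K ∖ T adjacent to T and split the family according to whether
-- S contains x.  The sets containing x form the family for (T ∪ {x}, K).  The sets
-- avoiding x form the family for (T, C), where C is their union, the largest
-- connected set between T and K avoiding x.  By maximality the only vertex of K ∖ C
-- with a neighbour in C is x, so E = K ∖ C is connected and contains connected sets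
-- D ∋ x of every size 1 … |E|.  The maps S ↦ S ∪ D then inject the sets avoiding x,
-- |E| times over, into those containing x, which pays for the weaker bound
-- (|C| + |T|)/2 on the second family.
module Submission where

open import Level using (0ℓ)
open import Data.Nat using (ℕ; zero; suc; _+_; _*_; _≤_; _<_; z≤n; s≤s)
open import Data.Nat.Properties hiding (_≟_)
open import Data.Nat.ListAction using (sum)
open import Data.Nat.ListAction.Properties using (sum-++; sum-↭)
open import Data.Nat.Tactic.RingSolver using (solve-∀)
open import Data.Bool using (true; false)
open import Data.Vec using ([]; _∷_; here; there)
open import Data.Fin using (Fin; zero; suc; toℕ; _≟_)
open import Data.Fin.Properties using (toℕ-injective; toℕ<n)
open import Data.Fin.Subset
open import Data.Fin.Subset.Properties
open import Data.List
  using (List; []; _∷_; _++_; length; map; filter; foldr; allFin; cartesianProduct)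
open import Data.List.Properties using (length-++; length-map; map-++; length-tabulate; length-removeAt′)
open import Data.List.Membership.Propositional using () renaming (_∈_ to _∈ˡ_; _─_ to _─ˡ_)
open import Data.List.Membership.Propositional.Properties
  using (∈-filter⁺; ∈-filter⁻; ∈-cartesianProduct⁻)
open import Data.List.Relation.Unary.Any using (here; there; index)
import Data.List.Relation.Unary.All as All
open import Data.List.Relation.Unary.Unique.Propositional using (Unique; []; _∷_)
open import Data.List.Relation.Unary.Unique.Propositional.Properties
  using (filter⁺; cartesianProduct⁺; allFin⁺)
open import Data.List.Relation.Binary.Permutation.Propositional using (_↭_; ↭-refl; ↭-trans; ↭-prep)
open import Data.List.Relation.Binary.Permutation.Propositional.Properties using (↭-length; map⁺; shift)
open import Data.Product using (∃; ∃₂; _×_; _,_; proj₁; proj₂)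
open import Data.Sum using (_⊎_; inj₁; inj₂; [_,_]′)
open import Data.Empty using (⊥-elim)
open import Function using (_∘_; id)
open import Function.Bundles using (_⇔_; mk⇔; Equivalence)
open import Relation.Nullary using (yes; no)
open import Relation.Unary using (Pred; Decidable)
open import Relation.Unary.Properties using (∁?)
open import Relation.Binary.PropositionalEquality
  using (_≡_; _≢_; refl; sym; trans; cong; cong₂; subst; subst₂; module ≡-Reasoning)

open import Defs hiding (sym)

private
  variable
    n : ℕ
    p q r : Subset n
    x : Fin n

x∈p─q⇒x∉q : x ∈ p ─ q → x ∉ q
x∈p─q⇒x∉q {x = zero} {p = _ ∷ _} {q = true ∷ _} () here
x∈p─q⇒x∉q {x = suc _} {p = _ ∷ _} {q = _ ∷ _} (there x∈) (there x∈q) = x∈p─q⇒x∉q x∈ x∈q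

⁅⁆⊆ : x ∈ p → ⁅ x ⁆ ⊆ p
⁅⁆⊆ {x = x} x∈p y∈⁅x⁆ = subst (_∈ _) (sym (x∈⁅y⁆⇒x≡y x y∈⁅x⁆)) x∈p

∪-least : p ⊆ r → q ⊆ r → p ∪ q ⊆ r
∪-least {p = p} {q = q} p⊆r q⊆r y∈p∪q with x∈p∪q⁻ p q y∈p∪q
... | inj₁ y∈p = p⊆r y∈p
... | inj₂ y∈q = q⊆r y∈q

Empty-─⇒⊆ : Empty (p ─ q) → p ⊆ q
Empty-─⇒⊆ {q = q} empty {y} y∈p with y ∈? q
... | yes y∈q = y∈q
... | no y∉q = ⊥-elim (empty (y , x∈p∧x∉q⇒x∈p─q y∈p y∉q))

∣p∣+∣q─p∣≡∣q∣ : p ⊆ q → ∣ p ∣ + ∣ q ─ p ∣ ≡ ∣ q ∣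
∣p∣+∣q─p∣≡∣q∣ {p = []} {q = []} _ = refl
∣p∣+∣q─p∣≡∣q∣ {p = true ∷ p} {q = true ∷ q} p⊆q = cong suc (∣p∣+∣q─p∣≡∣q∣ (drop-∷-⊆ p⊆q))
∣p∣+∣q─p∣≡∣q∣ {p = true ∷ p} {q = false ∷ q} p⊆q with p⊆q here
... | ()
∣p∣+∣q─p∣≡∣q∣ {p = false ∷ p} {q = true ∷ q} p⊆q =
  trans (+-suc ∣ p ∣ ∣ q ─ p ∣) (cong suc (∣p∣+∣q─p∣≡∣q∣ (drop-∷-⊆ p⊆q)))
∣p∣+∣q─p∣≡∣q∣ {p = false ∷ p} {q = false ∷ q} p⊆q = ∣p∣+∣q─p∣≡∣q∣ (drop-∷-⊆ p⊆q)

∣p∪⁅x⁆∣≡1+∣p∣ : x ∉ p → ∣ p ∪ ⁅ x ⁆ ∣ ≡ suc ∣ p ∣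
∣p∪⁅x⁆∣≡1+∣p∣ {x = zero} {p = true ∷ p} x∉p = ⊥-elim (x∉p here)
∣p∪⁅x⁆∣≡1+∣p∣ {x = zero} {p = false ∷ p} _ = cong (suc ∘ ∣_∣) (∪-identityʳ p)
∣p∪⁅x⁆∣≡1+∣p∣ {x = suc x} {p = true ∷ p} x∉p = cong suc (∣p∪⁅x⁆∣≡1+∣p∣ (x∉p ∘ there))
∣p∪⁅x⁆∣≡1+∣p∣ {x = suc x} {p = false ∷ p} x∉p = ∣p∪⁅x⁆∣≡1+∣p∣ (x∉p ∘ there)

module _ (disjoint : ∀ {y} → y ∈ r → y ∉ q) (p⊆q : p ⊆ q) where

  ∪-∩-cancel : (p ∪ r) ∩ q ≡ p
  ∪-∩-cancel = ⊆-antisym ⊆p (λ y∈p → x∈p∩q⁺ (p⊆p∪q r y∈p , p⊆q y∈p))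
    where
    ⊆p : (p ∪ r) ∩ q ⊆ p
    ⊆p y∈ with x∈p∩q⁻ (p ∪ r) q y∈
    ... | y∈p∪r , y∈q with x∈p∪q⁻ p r y∈p∪r
    ...   | inj₁ y∈p = y∈p
    ...   | inj₂ y∈r = ⊥-elim (disjoint y∈r y∈q)

  ∪-─-cancel : (p ∪ r) ─ q ≡ r
  ∪-─-cancel = ⊆-antisym ⊆r (λ y∈r → x∈p∧x∉q⇒x∈p─q (q⊆p∪q p r y∈r) (disjoint y∈r))
    where
    ⊆r : (p ∪ r) ─ q ⊆ r
    ⊆r y∈ with x∈p∪q⁻ p r (p─q⊆p (p ∪ r) q y∈)
    ... | inj₁ y∈p = ⊥-elim (x∈p─q⇒x∉q y∈ (p⊆q y∈p))
    ... | inj₂ y∈r = y∈r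

⊆-foldr-∪ : ∀ Ss → p ⊆ foldr _∪_ p Ss
⊆-foldr-∪ [] = λ y∈p → y∈p
⊆-foldr-∪ (S ∷ Ss) = q⊆p∪q S _ ∘ ⊆-foldr-∪ Ss

∈⇒⊆-foldr-∪ : ∀ {S Ss} → S ∈ˡ Ss → S ⊆ foldr _∪_ p Ss
∈⇒⊆-foldr-∪ {Ss = _ ∷ Ss} (here refl) = p⊆p∪q (foldr _∪_ _ Ss)
∈⇒⊆-foldr-∪ {Ss = S ∷ _} (there S∈Ss) = q⊆p∪q S _ ∘ ∈⇒⊆-foldr-∪ S∈Ss

∈-foldr-∪⁻ : ∀ Ss → x ∈ foldr _∪_ p Ss → x ∈ p ⊎ ∃ λ S → S ∈ˡ Ss × x ∈ S
∈-foldr-∪⁻ [] x∈p = inj₁ x∈p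
∈-foldr-∪⁻ (S ∷ Ss) x∈ with x∈p∪q⁻ S (foldr _∪_ _ Ss) x∈
... | inj₁ x∈S = inj₂ (S , here refl , x∈S)
... | inj₂ x∈rest with ∈-foldr-∪⁻ Ss x∈rest
...   | inj₁ x∈p = inj₁ x∈p
...   | inj₂ (S′ , S′∈Ss , x∈S′) = inj₂ (S′ , there S′∈Ss , x∈S′)

∈-─⁺ : ∀ {A : Set} {a b : A} {xs} (a∈xs : a ∈ˡ xs) → b ∈ˡ xs → b ≢ a → b ∈ˡ xs ─ˡ a∈xs
∈-─⁺ (here refl) (here refl) b≢a = ⊥-elim (b≢a refl)
∈-─⁺ (here refl) (there b∈xs) _ = b∈xs
∈-─⁺ (there a∈xs) (here refl) _ = here refl
∈-─⁺ (there a∈xs) (there b∈xs) b≢a = there (∈-─⁺ a∈xs b∈xs b≢a)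

module _ {A B : Set} where

  length-≤-injection : (f : A → B) {xs : List A} {ys : List B} → Unique xs →
    (∀ {a b} → a ∈ˡ xs → b ∈ˡ xs → f a ≡ f b → a ≡ b) →
    (∀ {a} → a ∈ˡ xs → f a ∈ˡ ys) → length xs ≤ length ys
  length-≤-injection f {[]} _ _ _ = z≤n
  length-≤-injection f {b ∷ xs} {ys} (b∉xs ∷ unique) injective into = begin
    suc (length xs)             ≤⟨ s≤s (length-≤-injection f unique injective′ into′) ⟩
    suc (length (ys ─ˡ fb∈ys))  ≡⟨ sym (length-removeAt′ ys (index fb∈ys)) ⟩
    length ys                   ∎
    where
    open ≤-Reasoning
    fb∈ys = into (here refl)
    injective′ : ∀ {a c} → a ∈ˡ xs → c ∈ˡ xs → f a ≡ f c → a ≡ c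
    injective′ a∈ c∈ = injective (there a∈) (there c∈)
    into′ : ∀ {a} → a ∈ˡ xs → f a ∈ˡ ys ─ˡ fb∈ys
    into′ a∈ = ∈-─⁺ fb∈ys (into (there a∈))
                 (λ fa≡fb → All.lookup b∉xs a∈ (sym (injective (there a∈) (here refl) fa≡fb)))

  length-cartesianProduct : ∀ (xs : List A) (ys : List B) →
    length (cartesianProduct xs ys) ≡ length xs * length ys
  length-cartesianProduct [] ys = refl
  length-cartesianProduct (a ∷ xs) ys =
    trans (length-++ (map (a ,_) ys))
          (cong₂ _+_ (length-map (a ,_) ys) (length-cartesianProduct xs ys))

module _ {A : Set} {P : Pred A 0ℓ} (P? : Decidable P) where

  filter-++-filter-∁-↭ : ∀ xs → filter P? xs ++ filter (∁? P?) xs ↭ xs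
  filter-++-filter-∁-↭ [] = ↭-refl
  filter-++-filter-∁-↭ (a ∷ xs) with P? a
  ... | yes _ = ↭-prep a (filter-++-filter-∁-↭ xs)
  ... | no _ = ↭-trans (shift a (filter P? xs) (filter (∁? P?) xs))
                       (↭-prep a (filter-++-filter-∁-↭ xs))

  length-filter-∁ : ∀ xs → length xs ≡ length (filter P? xs) + length (filter (∁? P?) xs)
  length-filter-∁ xs = trans (sym (↭-length (filter-++-filter-∁-↭ xs))) (length-++ (filter P? xs))

  sum-map-filter-∁ : ∀ (f : A → ℕ) xs →
    sum (map f xs) ≡ sum (map f (filter P? xs)) + sum (map f (filter (∁? P?) xs))
  sum-map-filter-∁ f xs = begin
    sum (map f xs)                  ≡⟨ sym (sum-↭ (map⁺ f (filter-++-filter-∁-↭ xs))) ⟩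
    sum (map f (ys ++ zs))          ≡⟨ cong sum (map-++ f ys zs) ⟩
    sum (map f ys ++ map f zs)      ≡⟨ sum-++ (map f ys) (map f zs) ⟩
    sum (map f ys) + sum (map f zs) ∎
    where
    open ≡-Reasoning
    ys = filter P? xs
    zs = filter (∁? P?) xs

Enumerates : {A : Set} → Pred A 0ℓ → List A → Set
Enumerates P L = Unique L × (∀ a → a ∈ˡ L ⇔ P a)

module _ {A : Set} {P Q : Pred A 0ℓ} where

  Enumerates-cong : (∀ a → P a ⇔ Q a) → ∀ {L} → Enumerates P L → Enumerates Q L
  Enumerates-cong P⇔Q (unique , ∈⇔P) = unique , λ a →
    mk⇔ (Equivalence.to (P⇔Q a) ∘ Equivalence.to (∈⇔P a))
        (Equivalence.from (∈⇔P a) ∘ Equivalence.from (P⇔Q a))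

  Enumerates-filter : (Q? : Decidable Q) → ∀ {L} → Enumerates P L →
    Enumerates (λ a → P a × Q a) (filter Q? L)
  Enumerates-filter Q? {L} (unique , ∈⇔P) = filter⁺ Q? unique , λ a →
    mk⇔ (λ a∈ → let a∈L , Qa = ∈-filter⁻ Q? {xs = L} a∈ in Equivalence.to (∈⇔P a) a∈L , Qa)
        (λ (Pa , Qa) → ∈-filter⁺ Q? (Equivalence.from (∈⇔P a) Pa) Qa)

*-length≤2*totalSize : ∀ c (L : List (Subset n)) → (∀ {S} → S ∈ˡ L → c ≤ 2 * ∣ S ∣) →
  c * length L ≤ 2 * totalSize L
*-length≤2*totalSize c [] _ = ≤-reflexive (*-zeroʳ c)
*-length≤2*totalSize c (S ∷ L) c≤ = begin
  c * suc (length L)           ≡⟨ *-suc c (length L) ⟩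
  c + c * length L             ≤⟨ +-mono-≤ (c≤ (here refl)) (*-length≤2*totalSize c L (c≤ ∘ there)) ⟩
  2 * ∣ S ∣ + 2 * totalSize L  ≡⟨ sym (*-distribˡ-+ 2 ∣ S ∣ (totalSize L)) ⟩
  2 * totalSize (S ∷ L)        ∎
  where open ≤-Reasoning

combine-bounds : ∀ {k c e t NA NB SA SB} → c + e ≡ k →
  (k + suc t) * NA ≤ 2 * SA → (c + t) * NB ≤ 2 * SB → e * NB ≤ NA →
  (k + t) * (NA + NB) ≤ 2 * (SA + SB)
combine-bounds {c = c} {e} {t} {NA} {NB} {SA} {SB} refl boundA boundB eNB≤NA = begin
  (c + e + t) * (NA + NB)                    ≡⟨ expand c e t NA NB ⟩
  ((c + e + t) * NA + (c + t) * NB) + e * NB ≤⟨ +-monoʳ-≤ ((c + e + t) * NA + (c + t) * NB) eNB≤NA ⟩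
  ((c + e + t) * NA + (c + t) * NB) + NA     ≡⟨ regroup c e t NA NB ⟩
  (c + e + suc t) * NA + (c + t) * NB        ≤⟨ +-mono-≤ boundA boundB ⟩
  2 * SA + 2 * SB                            ≡⟨ sym (*-distribˡ-+ 2 SA SB) ⟩
  2 * (SA + SB)                              ∎
  where
  open ≤-Reasoning
  expand : ∀ c e t NA NB → (c + e + t) * (NA + NB) ≡ ((c + e + t) * NA + (c + t) * NB) + e * NB
  expand = solve-∀
  regroup : ∀ c e t NA NB → ((c + e + t) * NA + (c + t) * NB) + NA ≡ (c + e + suc t) * NA + (c + t) * NB
  regroup = solve-∀

module _ (G : Graph n) where

  reach-target∈ : ∀ {S u w} → Reach G S u w → w ∈ S
  reach-target∈ (here w∈S) = w∈S
  reach-target∈ (step _ _ w∈S) = w∈S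

  reach-mono : ∀ {S S′ u w} → S ⊆ S′ → Reach G S u w → Reach G S′ u w
  reach-mono S⊆S′ (here u∈S) = here (S⊆S′ u∈S)
  reach-mono S⊆S′ (step r adj w∈S) = step (reach-mono S⊆S′ r) adj (S⊆S′ w∈S)

  reach-trans : ∀ {S u v w} → Reach G S u v → Reach G S v w → Reach G S u w
  reach-trans r (here _) = r
  reach-trans r (step r′ adj w∈S) = step (reach-trans r r′) adj w∈S

  reach-sym : ∀ {S u w} → Reach G S u w → Reach G S w u
  reach-sym (here u∈S) = here u∈S
  reach-sym (step r adj w∈S) =
    reach-trans (step (here w∈S) (Graph.sym G adj) (reach-target∈ r)) (reach-sym r)

  avoid-or-enter : ∀ {S X u w} → u ∉ X → Reach G S u w →
    Reach G (S ─ X) u w ⊎ ∃₂ λ y z → Reach G (S ─ X) u y × z ∈ X × Adj G y z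
  avoid-or-enter u∉X (here u∈S) = inj₁ (here (x∈p∧x∉q⇒x∈p─q u∈S u∉X))
  avoid-or-enter {X = X} u∉X (step {y = w} r adj w∈S) with avoid-or-enter u∉X r
  ... | inj₂ entry = inj₂ entry
  ... | inj₁ r′ with w ∈? X
  ...   | yes w∈X = inj₂ (_ , w , r′ , w∈X , adj)
  ...   | no w∉X = inj₁ (step r′ adj (x∈p∧x∉q⇒x∈p─q w∈S w∉X))

  entry-edge : ∀ {S X u w} → u ∉ X → w ∈ X → Reach G S u w →
    ∃₂ λ y z → Reach G (S ─ X) u y × z ∈ X × Adj G y z
  entry-edge u∉X w∈X r with avoid-or-enter u∉X r
  ... | inj₁ r′ = ⊥-elim (x∈p─q⇒x∉q (reach-target∈ r′) w∈X)
  ... | inj₂ entry = entry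

  ⁅⁆-connected : ∀ x → InducesConnected G ⁅ x ⁆
  ⁅⁆-connected x u w u∈ w∈ with x∈⁅y⁆⇒x≡y x u∈ | x∈⁅y⁆⇒x≡y x w∈
  ... | refl | refl = here u∈

  ∪-connected : ∀ {S₁ S₂ a b} → InducesConnected G S₁ → InducesConnected G S₂ →
    a ∈ S₁ → b ∈ S₂ → Reach G (S₁ ∪ S₂) a b → InducesConnected G (S₁ ∪ S₂)
  ∪-connected {S₁} {S₂} {a} {b} S₁-conn S₂-conn a∈S₁ b∈S₂ a⇝b u w u∈ w∈ =
    reach-trans (to-a u∈) (reach-sym (to-a w∈))
    where
    to-a : ∀ {y} → y ∈ S₁ ∪ S₂ → Reach G (S₁ ∪ S₂) y a
    to-a {y} y∈ with x∈p∪q⁻ S₁ S₂ y∈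
    ... | inj₁ y∈S₁ = reach-mono (p⊆p∪q S₂) (S₁-conn y a y∈S₁ a∈S₁)
    ... | inj₂ y∈S₂ = reach-trans (reach-mono (q⊆p∪q S₁ S₂) (S₂-conn y b y∈S₂ b∈S₂)) (reach-sym a⇝b)

  ∪-connected-by-edge : ∀ {S₁ S₂ a b} → InducesConnected G S₁ → InducesConnected G S₂ →
    a ∈ S₁ → b ∈ S₂ → Adj G a b → InducesConnected G (S₁ ∪ S₂)
  ∪-connected-by-edge {S₁} {S₂} S₁-conn S₂-conn a∈S₁ b∈S₂ adj =
    ∪-connected S₁-conn S₂-conn a∈S₁ b∈S₂ (step (here (p⊆p∪q S₂ a∈S₁)) adj (q⊆p∪q S₁ S₂ b∈S₂))

  ∪⁅⁆-connected : ∀ {S y z} → InducesConnected G S → z ∈ S → Adj G y z →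
    InducesConnected G (S ∪ ⁅ y ⁆)
  ∪⁅⁆-connected {y = y} S-conn z∈S adj =
    ∪-connected-by-edge S-conn (⁅⁆-connected y) z∈S (x∈⁅x⁆ y) (Graph.sym G adj)

  foldr-∪-connected : ∀ {T t} → t ∈ T → InducesConnected G T → ∀ Ss →
    (∀ {S} → S ∈ˡ Ss → InducesConnected G S × T ⊆ S) → InducesConnected G (foldr _∪_ T Ss)
  foldr-∪-connected t∈T T-conn [] _ = T-conn
  foldr-∪-connected {T} t∈T T-conn (S ∷ Ss) members =
    ∪-connected S-conn (foldr-∪-connected t∈T T-conn Ss (members ∘ there))
      (T⊆S t∈T) (⊆-foldr-∪ Ss t∈T) (here (p⊆p∪q (foldr _∪_ T Ss) (T⊆S t∈T)))
    where
    S-conn = proj₁ (members (here refl))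
    T⊆S = proj₂ (members (here refl))

  grow-connected-subset : ∀ {E D x} → InducesConnected G E → D ⊆ E → x ∈ D →
    InducesConnected G D → ∣ D ∣ < ∣ E ∣ →
    ∃ λ D′ → D′ ⊆ E × x ∈ D′ × InducesConnected G D′ × ∣ D′ ∣ ≡ suc ∣ D ∣
  grow-connected-subset {E} {D} {x} E-conn D⊆E x∈D D-conn ∣D∣<∣E∣ with nonempty? (E ─ D)
  ... | no E─D-empty = ⊥-elim (<⇒≱ ∣D∣<∣E∣ (p⊆q⇒∣p∣≤∣q∣ (Empty-─⇒⊆ E─D-empty)))
  ... | yes (z , z∈E─D)
    with y , w , z⇝y , w∈D , adj ← entry-edge (x∈p─q⇒x∉q z∈E─D) x∈D
                                     (E-conn z x (p─q⊆p E D z∈E─D) (D⊆E x∈D))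
    = D ∪ ⁅ y ⁆ , ∪-least D⊆E (⁅⁆⊆ (p─q⊆p E D y∈E─D)) , p⊆p∪q ⁅ y ⁆ x∈D
    , ∪⁅⁆-connected D-conn w∈D adj , ∣p∪⁅x⁆∣≡1+∣p∣ (x∈p─q⇒x∉q y∈E─D)
    where y∈E─D = reach-target∈ z⇝y

  connected-subset-of-size : ∀ {E x} → InducesConnected G E → x ∈ E → ∀ j → suc j ≤ ∣ E ∣ →
    ∃ λ D → D ⊆ E × x ∈ D × InducesConnected G D × ∣ D ∣ ≡ suc j
  connected-subset-of-size {x = x} _ x∈E zero _ =
    ⁅ x ⁆ , ⁅⁆⊆ x∈E , x∈⁅x⁆ x , ⁅⁆-connected x , ∣⁅x⁆∣≡1 x
  connected-subset-of-size {E} E-conn x∈E (suc j) 2+j≤∣E∣ =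
    let D , D⊆E , x∈D , D-conn , ∣D∣≡1+j =
          connected-subset-of-size E-conn x∈E j (≤-trans (n≤1+n (suc j)) 2+j≤∣E∣)
        D′ , D′⊆E , x∈D′ , D′-conn , ∣D′∣≡1+∣D∣ =
          grow-connected-subset E-conn D⊆E x∈D D-conn (subst (_< ∣ E ∣) (sym ∣D∣≡1+j) 2+j≤∣E∣)
    in D′ , D′⊆E , x∈D′ , D′-conn , trans ∣D′∣≡1+∣D∣ (cong suc ∣D∣≡1+j)

  ─-connected : ∀ {K C x} → InducesConnected G K → C ⊆ K → Nonempty C →
    (∀ {y z} → y ∈ K ─ C → z ∈ C → Adj G y z → y ≡ x) → InducesConnected G (K ─ C)
  ─-connected {K} {C} {x} K-conn C⊆K (t , t∈C) exits-at-x u w u∈ w∈ =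
    reach-trans (to-x u∈) (reach-sym (to-x w∈))
    where
    to-x : ∀ {u} → u ∈ K ─ C → Reach G (K ─ C) u x
    to-x {u} u∈ with entry-edge (x∈p─q⇒x∉q u∈) t∈C (K-conn u t (p─q⊆p K C u∈) (C⊆K t∈C))
    ... | y , z , u⇝y , z∈C , adj with exits-at-x (reach-target∈ u⇝y) z∈C adj
    ...   | refl = u⇝y

  ConnectedBetween : Subset n → Subset n → Pred (Subset n) 0ℓ
  ConnectedBetween T K S = InducesConnected G S × T ⊆ S × S ⊆ K

  ConnectedBetween-∪⁅⁆ : ∀ {T K x} S →
    (ConnectedBetween T K S × x ∈ S) ⇔ ConnectedBetween (T ∪ ⁅ x ⁆) K S
  ConnectedBetween-∪⁅⁆ {T} {x = x} S = mk⇔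
    (λ ((S-conn , T⊆S , S⊆K) , x∈S) → S-conn , ∪-least T⊆S (⁅⁆⊆ x∈S) , S⊆K)
    (λ (S-conn , T∪x⊆S , S⊆K) →
       (S-conn , T∪x⊆S ∘ p⊆p∪q ⁅ x ⁆ , S⊆K) , T∪x⊆S (q⊆p∪q T ⁅ x ⁆ (x∈⁅x⁆ x)))

  module _ {T C K : Subset n} {x q : Fin n} (C⊆K : C ⊆ K) (E-conn : InducesConnected G (K ─ C))
           (x∈E : x ∈ K ─ C) (q∈T : q ∈ T) (adj : Adj G x q) where

    layer : ∀ (i : Fin ∣ K ─ C ∣) →
      ∃ λ D → D ⊆ K ─ C × x ∈ D × InducesConnected G D × ∣ D ∣ ≡ suc (toℕ i)
    layer i = connected-subset-of-size E-conn x∈E (toℕ i) (toℕ<n i)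

    glue : Subset n × Fin ∣ K ─ C ∣ → Subset n
    glue (S , i) = S ∪ proj₁ (layer i)

    glue-injective : ∀ {S S′ i i′} → S ⊆ C → S′ ⊆ C →
      glue (S , i) ≡ glue (S′ , i′) → (S , i) ≡ (S′ , i′)
    glue-injective {S} {S′} {i} {i′} S⊆C S′⊆C S∪D≡S′∪D′ =
      let D , D⊆E , _ , _ , ∣D∣≡ = layer i
          D′ , D′⊆E , _ , _ , ∣D′∣≡ = layer i′
          D∩C=∅ = λ {y} y∈D → x∈p─q⇒x∉q {x = y} (D⊆E y∈D)
          D′∩C=∅ = λ {y} y∈D′ → x∈p─q⇒x∉q {x = y} (D′⊆E y∈D′)
          S≡S′ = begin
            S                ≡⟨ sym (∪-∩-cancel D∩C=∅ S⊆C) ⟩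
            (S ∪ D) ∩ C      ≡⟨ cong (_∩ C) S∪D≡S′∪D′ ⟩
            (S′ ∪ D′) ∩ C    ≡⟨ ∪-∩-cancel D′∩C=∅ S′⊆C ⟩
            S′               ∎
          D≡D′ = begin
            D                ≡⟨ sym (∪-─-cancel D∩C=∅ S⊆C) ⟩
            (S ∪ D) ─ C      ≡⟨ cong (_─ C) S∪D≡S′∪D′ ⟩
            (S′ ∪ D′) ─ C    ≡⟨ ∪-─-cancel D′∩C=∅ S′⊆C ⟩
            D′               ∎
          i≡i′ = toℕ-injective (suc-injective (trans (sym ∣D∣≡) (trans (cong ∣_∣ D≡D′) ∣D′∣≡)))
      in cong₂ _,_ S≡S′ i≡i′
      where open ≡-Reasoning

    glue-between : ∀ {S} i → ConnectedBetween T C S → ConnectedBetween (T ∪ ⁅ x ⁆) K (glue (S , i))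
    glue-between {S} i (S-conn , T⊆S , S⊆C) =
      let D , D⊆E , x∈D , D-conn , _ = layer i
      in ∪-connected-by-edge S-conn D-conn (T⊆S q∈T) x∈D (Graph.sym G adj)
       , ∪-least (p⊆p∪q D ∘ T⊆S) (⁅⁆⊆ (q⊆p∪q S D x∈D))
       , ∪-least (C⊆K ∘ S⊆C) (p─q⊆p K C ∘ D⊆E)

    layers-count : ∀ {LA LB} → Enumerates (ConnectedBetween T C) LB →
      Enumerates (ConnectedBetween (T ∪ ⁅ x ⁆) K) LA → ∣ K ─ C ∣ * length LB ≤ length LA
    layers-count {LA} {LB} (LB-unique , ∈LB⇔) (_ , ∈LA⇔) = begin
      ∣ K ─ C ∣ * length LB                  ≡⟨ *-comm ∣ K ─ C ∣ (length LB) ⟩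
      length LB * ∣ K ─ C ∣                  ≡⟨ cong (length LB *_) (sym (length-tabulate id)) ⟩
      length LB * length (allFin ∣ K ─ C ∣)  ≡⟨ sym (length-cartesianProduct LB (allFin _)) ⟩
      length pairs                           ≤⟨ length-≤-injection glue pairs-unique injective into ⟩
      length LA                              ∎
      where
      open ≤-Reasoning
      pairs = cartesianProduct LB (allFin ∣ K ─ C ∣)
      pairs-unique = cartesianProduct⁺ LB-unique (allFin⁺ ∣ K ─ C ∣)
      between : ∀ {a} → a ∈ˡ pairs → ConnectedBetween T C (proj₁ a)
      between a∈ = Equivalence.to (∈LB⇔ _) (proj₁ (∈-cartesianProduct⁻ LB _ a∈))
      injective : ∀ {a b} → a ∈ˡ pairs → b ∈ˡ pairs → glue a ≡ glue b → a ≡ b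
      injective a∈ b∈ = glue-injective (proj₂ (proj₂ (between a∈))) (proj₂ (proj₂ (between b∈)))
      into : ∀ {a} → a ∈ˡ pairs → glue a ∈ˡ LA
      into {_ , i} a∈ = Equivalence.from (∈LA⇔ _) (glue-between i (between a∈))

  module AvoidingHull {T K : Subset n} {x t : Fin n} (t∈T : t ∈ T) (T-conn : InducesConnected G T)
    (T⊆K : T ⊆ K) (x∉T : x ∉ T) {LB} (enum : Enumerates (λ S → ConnectedBetween T K S × x ∉ S) LB)
    where

    hull : Subset n
    hull = foldr _∪_ T LB

    member : ∀ {S} → S ∈ˡ LB → ConnectedBetween T K S × x ∉ S
    member {S} = Equivalence.to (proj₂ enum S)

    T⊆hull : T ⊆ hull
    T⊆hull = ⊆-foldr-∪ LB

    hull⊆K : hull ⊆ K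
    hull⊆K y∈ with ∈-foldr-∪⁻ LB y∈
    ... | inj₁ y∈T = T⊆K y∈T
    ... | inj₂ (S , S∈LB , y∈S) = let (_ , _ , S⊆K) , _ = member S∈LB in S⊆K y∈S

    x∉hull : x ∉ hull
    x∉hull x∈ with ∈-foldr-∪⁻ LB x∈
    ... | inj₁ x∈T = x∉T x∈T
    ... | inj₂ (S , S∈LB , x∈S) = proj₂ (member S∈LB) x∈S

    hull-connected : InducesConnected G hull
    hull-connected = foldr-∪-connected t∈T T-conn LB
      (λ S∈LB → let (S-conn , T⊆S , _) , _ = member S∈LB in S-conn , T⊆S)

    maximal : ∀ {S} → ConnectedBetween T K S → x ∉ S → S ⊆ hull
    maximal between x∉S = ∈⇒⊆-foldr-∪ (Equivalence.from (proj₂ enum _) (between , x∉S))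

    exits-at-x : ∀ {y z} → y ∈ K ─ hull → z ∈ hull → Adj G y z → y ≡ x
    exits-at-x {y} y∈K─hull z∈hull adj with y ≟ x
    ... | yes y≡x = y≡x
    ... | no y≢x =
      ⊥-elim (x∈p─q⇒x∉q y∈K─hull (maximal extended x∉extended (q⊆p∪q hull ⁅ y ⁆ (x∈⁅x⁆ y))))
      where
      extended : ConnectedBetween T K (hull ∪ ⁅ y ⁆)
      extended = ∪⁅⁆-connected hull-connected z∈hull adj , p⊆p∪q ⁅ y ⁆ ∘ T⊆hull
               , ∪-least hull⊆K (⁅⁆⊆ (p─q⊆p K hull y∈K─hull))
      x∉extended : x ∉ hull ∪ ⁅ y ⁆
      x∉extended x∈ = [ x∉hull , y≢x ∘ sym ∘ x∈⁅y⁆⇒x≡y y ]′ (x∈p∪q⁻ hull ⁅ y ⁆ x∈)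

    enumerates-between : Enumerates (ConnectedBetween T hull) LB
    enumerates-between = Enumerates-cong (λ S → mk⇔ to from) enum
      where
      to : ∀ {S} → ConnectedBetween T K S × x ∉ S → ConnectedBetween T hull S
      to ((S-conn , T⊆S , S⊆K) , x∉S) = S-conn , T⊆S , maximal (S-conn , T⊆S , S⊆K) x∉S
      from : ∀ {S} → ConnectedBetween T hull S → ConnectedBetween T K S × x ∉ S
      from (S-conn , T⊆S , S⊆hull) = (S-conn , T⊆S , hull⊆K ∘ S⊆hull) , x∉hull ∘ S⊆hull

  BetweenBound : ℕ → Set
  BetweenBound m = ∀ {T K L} → ConnectedSet G T → InducesConnected G K → T ⊆ K →
    ∣ K ∣ ≤ ∣ T ∣ + m → Enumerates (ConnectedBetween T K) L →
    (∣ K ∣ + ∣ T ∣) * length L ≤ 2 * totalSize L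

  between-bound-equal : ∀ {T K L} → K ⊆ T → Enumerates (ConnectedBetween T K) L →
    (∣ K ∣ + ∣ T ∣) * length L ≤ 2 * totalSize L
  between-bound-equal {T} {K} {L} K⊆T (_ , ∈L⇔) = *-length≤2*totalSize _ L λ {S} S∈L →
    let _ , T⊆S , _ = Equivalence.to (∈L⇔ S) S∈L
    in begin
      ∣ K ∣ + ∣ T ∣        ≤⟨ +-mono-≤ (p⊆q⇒∣p∣≤∣q∣ (T⊆S ∘ K⊆T)) (p⊆q⇒∣p∣≤∣q∣ T⊆S) ⟩
      ∣ S ∣ + ∣ S ∣        ≡⟨ cong (∣ S ∣ +_) (sym (+-identityʳ ∣ S ∣)) ⟩
      2 * ∣ S ∣            ∎
    where open ≤-Reasoning

  between-bound-step : ∀ {m} → BetweenBound m → ∀ {T K L x q} → ConnectedSet G T →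
    InducesConnected G K → T ⊆ K → ∣ K ∣ ≤ ∣ T ∣ + suc m → Enumerates (ConnectedBetween T K) L →
    x ∈ K ─ T → q ∈ T → Adj G x q → (∣ K ∣ + ∣ T ∣) * length L ≤ 2 * totalSize L
  between-bound-step {m} ih {T} {K} {L} {x} T-set@((t , t∈T) , T-conn) K-conn T⊆K ∣K∣≤ enum
                     x∈K─T q∈T adj = begin
    (∣ K ∣ + ∣ T ∣) * length L                ≡⟨ cong ((∣ K ∣ + ∣ T ∣) *_) (length-filter-∁ (x ∈?_) L) ⟩
    (∣ K ∣ + ∣ T ∣) * (length LA + length LB) ≤⟨ combine-bounds {c = ∣ C ∣} {∣ K ─ C ∣}
                                                   {SA = totalSize LA} {totalSize LB}
                                                   ∣C∣+∣K─C∣≡∣K∣ boundA boundB count ⟩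
    2 * (totalSize LA + totalSize LB)         ≡⟨ cong (2 *_) (sym (sum-map-filter-∁ (x ∈?_) ∣_∣ L)) ⟩
    2 * totalSize L                           ∎
    where
    open ≤-Reasoning
    x∉T = x∈p─q⇒x∉q x∈K─T
    x∈K = p─q⊆p K T x∈K─T
    LA = filter (x ∈?_) L
    LB = filter (∁? (x ∈?_)) L
    T′ = T ∪ ⁅ x ⁆

    T′-set : ConnectedSet G T′
    T′-set = (x , q⊆p∪q T ⁅ x ⁆ (x∈⁅x⁆ x)) , ∪⁅⁆-connected T-conn q∈T adj

    enumA : Enumerates (ConnectedBetween T′ K) LA
    enumA = Enumerates-cong ConnectedBetween-∪⁅⁆ (Enumerates-filter (x ∈?_) enum)

    open AvoidingHull t∈T T-conn T⊆K x∉T (Enumerates-filter (∁? (x ∈?_)) enum) renaming (hull to C)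

    ∣C∣+∣K─C∣≡∣K∣ : ∣ C ∣ + ∣ K ─ C ∣ ≡ ∣ K ∣
    ∣C∣+∣K─C∣≡∣K∣ = ∣p∣+∣q─p∣≡∣q∣ hull⊆K

    ∣T′∣≡1+∣T∣ : ∣ T′ ∣ ≡ suc ∣ T ∣
    ∣T′∣≡1+∣T∣ = ∣p∪⁅x⁆∣≡1+∣p∣ x∉T

    ∣K∣≤∣T′∣+m : ∣ K ∣ ≤ ∣ T′ ∣ + m
    ∣K∣≤∣T′∣+m = subst (∣ K ∣ ≤_) (trans (+-suc ∣ T ∣ m) (cong (_+ m) (sym ∣T′∣≡1+∣T∣))) ∣K∣≤

    ∣C∣≤∣T∣+m : ∣ C ∣ ≤ ∣ T ∣ + m
    ∣C∣≤∣T∣+m = ≤-pred (≤-trans (p⊂q⇒∣p∣<∣q∣ (hull⊆K , x , x∈K , x∉hull))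
                                 (subst (∣ K ∣ ≤_) (+-suc ∣ T ∣ m) ∣K∣≤))

    boundA : (∣ K ∣ + suc ∣ T ∣) * length LA ≤ 2 * totalSize LA
    boundA = subst (λ t′ → (∣ K ∣ + t′) * length LA ≤ 2 * totalSize LA) ∣T′∣≡1+∣T∣
      (ih T′-set K-conn (∪-least T⊆K (⁅⁆⊆ x∈K)) ∣K∣≤∣T′∣+m enumA)

    boundB : (∣ C ∣ + ∣ T ∣) * length LB ≤ 2 * totalSize LB
    boundB = ih T-set hull-connected T⊆hull ∣C∣≤∣T∣+m enumerates-between

    count : ∣ K ─ C ∣ * length LB ≤ length LA
    count = layers-count hull⊆K (─-connected K-conn hull⊆K (t , T⊆hull t∈T) exits-at-x)
      (x∈p∧x∉q⇒x∈p─q x∈K x∉hull) q∈T adj enumerates-between enumA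

  between-bound : ∀ m → BetweenBound m
  between-bound m {T} {K} T-set K-conn T⊆K ∣K∣≤ enum with nonempty? (K ─ T)
  ... | no K─T-empty = between-bound-equal (Empty-─⇒⊆ K─T-empty) enum
  between-bound zero {T} {K} T-set K-conn T⊆K ∣K∣≤ enum | yes (z , z∈K─T) =
    ⊥-elim (<⇒≱ (p⊂q⇒∣p∣<∣q∣ (T⊆K , z , p─q⊆p K T z∈K─T , x∈p─q⇒x∉q z∈K─T))
                (subst (∣ K ∣ ≤_) (+-identityʳ ∣ T ∣) ∣K∣≤))
  between-bound (suc m) {T} {K} T-set@((t , t∈T) , _) K-conn T⊆K ∣K∣≤ enum | yes (z , z∈K─T)
    with _ , q , z⇝x , q∈T , adj ← entry-edge (x∈p─q⇒x∉q z∈K─T) t∈T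
                                     (K-conn z t (p─q⊆p K T z∈K─T) (T⊆K t∈T))
    = between-bound-step (between-bound m) T-set K-conn T⊆K ∣K∣≤ enum (reach-target∈ z⇝x) q∈T adj

lemma2 : ∀ {n} (G : Graph n) → ConnectedGraph G → (v : Fin n) →
           (L : List (Subset n)) → EnumeratesConnectedSetsAt G v L →
           (order G + 1) * length L ≤ 2 * totalSize L
lemma2 {n} G (_ , G-conn) v L (L-unique , ∈L⇔) =
  subst₂ (λ a b → (a + b) * length L ≤ 2 * totalSize L) (∣⊤∣≡n n) (∣⁅x⁆∣≡1 v)
    (between-bound G n ((v , x∈⁅x⁆ v) , ⁅⁆-connected G v) G-conn ⊆⊤
      (≤-trans (∣p∣≤n ⊤) (m≤n+m n ∣ ⁅ v ⁆ ∣)) (L-unique , λ S → mk⇔ (to S) (from S)))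
  where
  to : ∀ S → S ∈ˡ L → ConnectedBetween G ⁅ v ⁆ ⊤ S
  to S S∈L = let (_ , S-conn) , v∈S = Equivalence.to (∈L⇔ S) S∈L in S-conn , ⁅⁆⊆ v∈S , ⊆⊤
  from : ∀ S → ConnectedBetween G ⁅ v ⁆ ⊤ S → S ∈ˡ L
  from S (S-conn , v⊆S , _) = Equivalence.from (∈L⇔ S) (((v , v∈S) , S-conn) , v∈S)
    where v∈S = v⊆S (x∈⁅x⁆ v)
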